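{- Let $k\ge 2$, $j\ge 1$, and let $\Upsilon$ be a set of pairs $(\tau,u)$ with $\tau\in S_j$, $u\in\{0,\dots,k-1\}^j$ and $\mathrm{red}(u)=u$. Define $$A_k^{\Upsilon}(p,q,r,t)=\sum_{n\ge0}\frac{t^n}{[n]_{p,q}!}\sum_{\substack{(\sigma,w)\in C_k\wr S_n\\ \Upsilon\text{ -mch}(\sigma,w)=0}}q^{\mathrm{inv}(\sigma)}p^{\mathrm{coinv}(\sigma)}r^{\|w\|},\qquad B_k^{\Upsilon}(p,q,r,t)=\sum_{n\ge1}\frac{t^n}{[n]_{p,q}!}\sum_{(\sigma,w)\in (C_k\wr S_n)_{\mathrm{end}}}q^{\mathrm{inv}(\sigma)}p^{\mathrm{coinv}(\sigma)}r^{\|w\|},$$ where $(C_k\wr S_n)_{\mathrm{end}}$ is the set of $(\sigma,w)\in C_k\wr S_n$ that have exactly one $\Upsilon$-bi-match and this bi-match starts at position $n-j+1$. Then $B_k^{\Upsilon}(p,q,r,t)=([k]_r t-1)A_k^{\Upsilon}(p,q,r,t)+1$.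
   Context: $C_k\wr S_n$ is identified with the set of pairs $(\sigma,w)$, $\sigma=\sigma_1\cdots\sigma_n\in S_n$, $w=w_1\cdots w_n\in\{0,\dots,k-1\}^n$ (one empty element for $n=0$). For a sequence of distinct integers, $\mathrm{red}$ replaces the $i$-th smallest entry by $i$; for a word of integers, $\mathrm{red}$ replaces the $i$-th smallest distinct value occurring by $i-1$ (e.g. $\mathrm{red}(2\,7\,2\,4\,7)=0\,2\,0\,1\,2$). $(\sigma,w)$ has a $\Upsilon$-bi-match starting at position $i$ ($1\le i\le n-j+1$) if $(\mathrm{red}(\sigma_i\cdots\sigma_{i+j-1}),\mathrm{red}(w_i\cdots w_{i+j-1}))\in\Upsilon$; $\Upsilon\text{ -mch}(\sigma,w)$ is the number of such $i$. $\mathrm{inv}(\sigma)=|\{a<b:\sigma_a>\sigma_b\}|$, $\mathrm{coinv}(\sigma)=|\{a<b:\sigma_a<\sigma_b\}|$, $\|w\|=w_1+\cdots+w_n$, $[n]_{p,q}=p^{n-1}+p^{n-2}q+\cdots+q^{n-1}$, $[n]_{p,q}!=[n]_{p,q}\cdots[1]_{p,q}$ ($[0]_{p,q}!=1$), $[k]_r=1+r+\cdots+r^{k-1}$. -}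

module Defs where

open import Level using (Level)
open import Data.Bool using (Bool; true; false; _∧_; not; if_then_else_)
open import Data.Nat using (ℕ; zero; suc; _+_; _∸_; _≤_; _<_; _<ᵇ_; _≡ᵇ_; _≟_)
open import Data.List using (List; []; _∷_; map; length; filterᵇ; upTo; take; drop; foldr; concatMap; cartesianProduct)
open import Data.Bool.ListAction using (any)
open import Data.List.Relation.Unary.All using (All)
open import Data.List.Properties using (≡-dec)
open import Data.Product using (_×_; _,_; proj₁; proj₂)
open import Relation.Nullary.Decidable using (⌊_⌋)
open import Relation.Binary.PropositionalEquality using (_≡_)
open import Algebra.Bundles using (CommutativeRing)

count : {A : Set} → (A → Bool) → List A → ℕ
count P xs = length (filterᵇ P xs)

words : ℕ → ℕ → List (List ℕ)
words zero    m = [] ∷ []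
words (suc n) m = concatMap (λ v → map (v ∷_) (words n m)) (upTo m)

distinct : List ℕ → Bool
distinct []       = true
distinct (x ∷ xs) = not (any (λ y → x ≡ᵇ y) xs) ∧ distinct xs

-- S_n : all permutations σ₁⋯σₙ of {1,…,n} in one-line notation
-- (the words of length n over {1,…,n} with distinct entries)
perms : ℕ → List (List ℕ)
perms n = filterᵇ distinct (map (map suc) (words n n))

wreath : ℕ → ℕ → List (List ℕ × List ℕ)
wreath k n = cartesianProduct (perms n) (words n k)

-- red on sequences of distinct integers: i-th smallest entry ↦ i
redσ : List ℕ → List ℕ
redσ s = map (λ x → suc (count (λ y → y <ᵇ x) s)) s

-- red on words: i-th smallest distinct value occurring ↦ i-1
memb : ℕ → List ℕ → Bool
memb v w = any (λ y → v ≡ᵇ y) w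

redw : List ℕ → List ℕ
redw w = map (λ x → count (λ v → memb v w) (upTo x)) w

eqL : List ℕ → List ℕ → Bool
eqL a b = ⌊ ≡-dec _≟_ a b ⌋

inΥ : List (List ℕ × List ℕ) → List ℕ × List ℕ → Bool
inΥ Υ (τ , u) = any (λ pr → eqL (proj₁ pr) τ ∧ eqL (proj₂ pr) u) Υ

-- Υ-bi-match starting at (0-indexed) position i, pattern length j
matchAt : List (List ℕ × List ℕ) → ℕ → List ℕ → List ℕ → ℕ → Bool
matchAt Υ j σ w i = inΥ Υ (redσ (take j (drop i σ)) , redw (take j (drop i w)))

mch : List (List ℕ × List ℕ) → ℕ → List ℕ → List ℕ → ℕ
mch Υ j σ w = count (matchAt Υ j σ w) (upTo (suc (length σ) ∸ j))

avoids : List (List ℕ × List ℕ) → ℕ → List ℕ × List ℕ → Bool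
avoids Υ j (σ , w) = mch Υ j σ w ≡ᵇ 0

-- (σ,w) ∈ (C_k ≀ S_n)_end : exactly one bi-match, starting at position n-j+1
-- (1-indexed), i.e. at 0-indexed position n-j
isEnd : List (List ℕ × List ℕ) → ℕ → List ℕ × List ℕ → Bool
isEnd Υ j (σ , w) = (mch Υ j σ w ≡ᵇ 1) ∧ matchAt Υ j σ w (length σ ∸ j)

inv : List ℕ → ℕ
inv []       = 0
inv (x ∷ xs) = count (λ y → y <ᵇ x) xs + inv xs

coinv : List ℕ → ℕ
coinv []       = 0
coinv (x ∷ xs) = count (λ y → x <ᵇ y) xs + coinv xs

norm : List ℕ → ℕ
norm = foldr _+_ 0

InS : ℕ → List ℕ → Set
InS j τ = (length τ ≡ j) × (distinct τ ≡ true) × All (λ x → (1 ≤ x) × (x ≤ j)) τ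

ValidΥ : ℕ → ℕ → List (List ℕ × List ℕ) → Set
ValidΥ k j Υ = All (λ pr → InS j (proj₁ pr) × (length (proj₂ pr) ≡ j)
                         × All (λ x → x < k) (proj₂ pr) × (redw (proj₂ pr) ≡ proj₂ pr)) Υ

module RingSums {c ℓ : Level} (R : CommutativeRing c ℓ) where
  open CommutativeRing R hiding (_+_)
  open CommutativeRing R using () renaming (_+_ to _+R_)

  pow : Carrier → ℕ → Carrier
  pow x zero    = 1#
  pow x (suc n) = x * pow x n

  sumR : List Carrier → Carrier
  sumR = foldr _+R_ 0#

  qint : Carrier → Carrier → ℕ → Carrier
  qint p q n = sumR (map (λ i → pow p (n ∸ suc i) * pow q i) (upTo n))

  rint : Carrier → ℕ → Carrier
  rint r k = sumR (map (pow r) (upTo k))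

  weight : Carrier → Carrier → Carrier → List ℕ × List ℕ → Carrier
  weight p q r (σ , w) = pow q (inv σ) * pow p (coinv σ) * pow r (norm w)

  -- Acoef n = [n]_{p,q}! · [t^n] A_k^Υ(p,q,r,t)
  Acoef : ℕ → ℕ → List (List ℕ × List ℕ) → Carrier → Carrier → Carrier → ℕ → Carrier
  Acoef k j Υ p q r n = sumR (map (weight p q r) (filterᵇ (avoids Υ j) (wreath k n)))

  -- Bcoef n = [n]_{p,q}! · [t^n] B_k^Υ(p,q,r,t)   (n ≥ 1)
  Bcoef : ℕ → ℕ → List (List ℕ × List ℕ) → Carrier → Carrier → Carrier → ℕ → Carrier
  Bcoef k j Υ p q r n = sumR (map (weight p q r) (filterᵇ (isEnd Υ j) (wreath k n)))

-- Every (σ′ , w′) ∈ C_k ≀ S_{n+1} arises exactly once from some (σ , w) ∈ C_k ≀ S_n by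
-- appending a letter a < k to w and a new last value n + 1 − i (0 ≤ i ≤ n) to σ, the old
-- values ≥ n + 1 − i being shifted up; this multiplies the weight by p^(n−i) q^i r^a.
-- Reduction is invariant under the shift, so every bi-match of (σ , w) survives and the only
-- possible new one sits in the last window. Hence extensions of a non-avoiding (σ , w) are
-- neither avoiding nor in (C_k ≀ S_{n+1})_end, while each extension of an avoiding one is
-- exactly one of the two. Summing weights gives B_{n+1} + A_{n+1} = [k]_r [n+1]_{p,q} A_n.

module Submission where

open import Defs
open import Level using (Level)
open import Function using (_∘_; _⇔_; mk⇔; Equivalence)
open import Data.Bool using (Bool; true; false; T; not; _∧_; if_then_else_)
open import Data.Bool.Properties using (∧-zeroʳ; ∧-identityʳ; T-∧)
open import Data.Empty using (⊥-elim)
open import Data.Nat using (ℕ; zero; suc; pred; _+_; _∸_; _≤_; _<_; _<ᵇ_; _≡ᵇ_; z≤n; s≤s; s<s; _≤?_; _<?_)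
open import Data.Nat.Properties
  using (<ᵇ⇒<; <⇒<ᵇ; ≡ᵇ⇒≡; ≡⇒≡ᵇ; suc-injective; ≤-refl; ≤-trans; ≤-antisym; ≤-pred; <⇒≤; <⇒≱; ≮⇒≥; ≰⇒>; ≤∧≢⇒<
        ; <-irrefl; <-asym; <-trans; <-≤-trans; ≤-<-trans; <-cmp; n<1+n; m<n⇒m<1+n; m≤n⇒m≤1+n; n≤0⇒n≡0
        ; +-comm; +-suc; +-identityʳ; +-monoˡ-<; +-∸-assoc; 0∸n≡0; m+n∸m≡n; m∸[m∸n]≡n; m∸n+n≡m; m≤n⇒m∸n≡0; m∸n≤m; ∸-cancelˡ-≡)
open import Data.Nat.ListAction.Properties using (sum-++)
open import Algebra.Properties.CommutativeSemigroup Data.Nat.Properties.+-commutativeSemigroup using (interchange)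
open import Data.List using (List; []; _∷_; _++_; _∷ʳ_; map; length; filterᵇ; upTo; take; drop; concatMap; initLast; _∷ʳ′_; cartesianProduct; cartesianProductWith)
open import Data.List.Properties using (take-map; drop-map; filter-++; filter-accept; filter-reject; length-++; map-∘; map-id-local; length-map; map-cong; applyUpTo-∷ʳ; ∷ʳ-injective; ∷ʳ-injectiveˡ; ∷ʳ-injectiveʳ; ∷-injective; map-injective)
open import Data.Product using (_×_; _,_; proj₁; proj₂; ∃-syntax)
open import Data.Sum using (_⊎_; inj₁; inj₂)
open import Relation.Binary.Core using (_Preserves_⟶_)
open import Relation.Binary.Definitions using (tri<; tri≈; tri>)
open import Relation.Binary.PropositionalEquality using (_≡_; _≢_; refl; sym; trans; cong; cong₂; subst; module ≡-Reasoning)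
open import Relation.Nullary using (¬_; Dec; yes; no)
open import Relation.Nullary.Decidable using (T?)
open import Data.List.Membership.Propositional using (_∈_; _∉_)
open import Data.List.Membership.Propositional.Properties
  using (∈-upTo⁺; ∈-upTo⁻; ∈-map⁺; ∈-map⁻; ∈-filter⁺; ∈-filter⁻; ∈-cartesianProductWith⁺; ∈-cartesianProductWith⁻; ∈-cartesianProduct⁺; ∈-cartesianProduct⁻)
open import Data.List.Membership.Propositional.Properties.WithK using (unique∧set⇒bag)
open import Data.List.Relation.Binary.BagAndSetEquality using (∼bag⇒↭)
open import Data.List.Relation.Binary.Permutation.Propositional using (_↭_; ↭⇒↭ₛ′)
import Data.List.Relation.Binary.Permutation.Propositional.Properties as ↭
import Data.List.Relation.Binary.Permutation.Setoid.Properties as ↭ₛ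
open import Algebra.Bundles using (CommutativeRing)
import Algebra.Properties.CommutativeSemigroup as CommSemigroup
import Algebra.Properties.Group
open import Data.List.Relation.Unary.Any using (here; there)
import Data.List.Relation.Unary.Any as Any
open import Data.List.Relation.Unary.Any.Properties using (any⁺; any⁻)
open import Data.List.Relation.Unary.All using (All; []; _∷_)
import Data.List.Relation.Unary.All as All
import Data.List.Relation.Unary.All.Properties as All
open import Data.List.Relation.Unary.Unique.Propositional using (Unique; []; _∷_)
import Data.List.Relation.Unary.Unique.Propositional.Properties as Unique

T-injective : ∀ {a b} → (T a → T b) → (T b → T a) → a ≡ b
T-injective {false} {false} _ _ = refl
T-injective {false} {true}  _ g = ⊥-elim (g _)
T-injective {true}  {false} f _ = ⊥-elim (f _)
T-injective {true}  {true}  _ _ = refl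

<ᵇ-cong : ∀ {m n m′ n′} → (m < n → m′ < n′) → (m′ < n′ → m < n) → (m <ᵇ n) ≡ (m′ <ᵇ n′)
<ᵇ-cong {m} {n} {m′} {n′} f g = T-injective (<⇒<ᵇ ∘ f ∘ <ᵇ⇒< m n) (<⇒<ᵇ ∘ g ∘ <ᵇ⇒< m′ n′)

if-<ᵇ-cases : ∀ {B : Set} x v (a b : B) →
              (x < v × (if x <ᵇ v then a else b) ≡ a) ⊎ (v ≤ x × (if x <ᵇ v then a else b) ≡ b)
if-<ᵇ-cases x v a b with x <ᵇ v in eq
... | true  = inj₁ (<ᵇ⇒< x v (subst T (sym eq) _) , refl)
... | false = inj₂ (≮⇒≥ (λ x<v → subst T eq (<⇒<ᵇ x<v)) , refl)

module _ {A : Set} where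

  count-++ : ∀ (P : A → Bool) xs ys → count P (xs ++ ys) ≡ count P xs + count P ys
  count-++ P xs ys = trans (cong length (filter-++ (T? ∘ P) xs ys)) (length-++ (filterᵇ P xs))

  count-map : ∀ {B : Set} (P : B → Bool) (f : A → B) xs → count P (map f xs) ≡ count (P ∘ f) xs
  count-map P f [] = refl
  count-map P f (x ∷ xs) with P (f x)
  ... | true  = cong suc (count-map P f xs)
  ... | false = count-map P f xs

  count-cong : ∀ {P Q : A → Bool} xs → (∀ {x} → x ∈ xs → P x ≡ Q x) → count P xs ≡ count Q xs
  count-cong [] _ = refl
  count-cong {P} {Q} (x ∷ xs) eq with P x | Q x | eq (here refl)
  ... | true  | true  | _ = cong suc (count-cong xs (eq ∘ there))
  ... | false | false | _ = count-cong xs (eq ∘ there)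

  count-singleton : ∀ (P : A → Bool) x → count P (x ∷ []) ≡ (if P x then 1 else 0)
  count-singleton P x with P x
  ... | true  = refl
  ... | false = refl

  count+count-not : ∀ (P : A → Bool) xs → count P xs + count (not ∘ P) xs ≡ length xs
  count+count-not P [] = refl
  count+count-not P (x ∷ xs) with P x
  ... | true  = cong suc (count+count-not P xs)
  ... | false = trans (+-suc _ _) (cong suc (count+count-not P xs))

module _ {f : ℕ → ℕ} (mono : f Preserves _<_ ⟶ _<_) where

  strictMono⇒<ᵇ-invariant : ∀ x y → (f x <ᵇ f y) ≡ (x <ᵇ y)
  strictMono⇒<ᵇ-invariant x y = <ᵇ-cong reflect mono
    where
    reflect : f x < f y → x < y
    reflect fx<fy with <-cmp x y
    ... | tri< x<y _ _  = x<y
    ... | tri≈ _ refl _ = ⊥-elim (<-irrefl refl fx<fy)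
    ... | tri> _ _ y<x  = ⊥-elim (<-asym fx<fy (mono y<x))

  strictMono⇒injective : ∀ {x y} → f x ≡ f y → x ≡ y
  strictMono⇒injective {x} {y} fx≡fy with <-cmp x y
  ... | tri< x<y _ _ = ⊥-elim (<-irrefl fx≡fy (mono x<y))
  ... | tri≈ _ x≡y _ = x≡y
  ... | tri> _ _ y<x = ⊥-elim (<-irrefl (sym fx≡fy) (mono y<x))

-- Shifting values up to make room for a new one

bump : ℕ → ℕ → ℕ
bump v x = if x <ᵇ v then x else suc x

unbump : ℕ → ℕ → ℕ
unbump v x = if x <ᵇ v then x else pred x

bump-<-mono : ∀ v → bump v Preserves _<_ ⟶ _<_
bump-<-mono v {x} {y} x<y with if-<ᵇ-cases x v x (suc x) | if-<ᵇ-cases y v y (suc y)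
... | inj₁ (_ , ex)   | inj₁ (_ , ey)   rewrite ex | ey = x<y
... | inj₁ (_ , ex)   | inj₂ (_ , ey)   rewrite ex | ey = m<n⇒m<1+n x<y
... | inj₂ (v≤x , _)  | inj₁ (y<v , _)  = ⊥-elim (<-irrefl refl (≤-<-trans v≤x (<-trans x<y y<v)))
... | inj₂ (_ , ex)   | inj₂ (_ , ey)   rewrite ex | ey = s<s x<y

bump-≢ : ∀ v x → bump v x ≢ v
bump-≢ v x with if-<ᵇ-cases x v x (suc x)
... | inj₁ (x<v , e) = λ b≡v → <-irrefl (trans (sym e) b≡v) x<v
... | inj₂ (v≤x , e) = λ b≡v → <-irrefl (trans (sym b≡v) e) (s≤s v≤x)

bump-unbump : ∀ v y → y ≢ v → bump v (unbump v y) ≡ y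
bump-unbump v y y≢v with if-<ᵇ-cases y v y (pred y)
... | inj₁ (y<v , e) rewrite e with if-<ᵇ-cases y v y (suc y)
...   | inj₁ (_ , e′)   = e′
...   | inj₂ (v≤y , _) = ⊥-elim (<⇒≱ y<v v≤y)
bump-unbump v zero    y≢v | inj₂ (v≤0 , _) = ⊥-elim (y≢v (sym (n≤0⇒n≡0 v≤0)))
bump-unbump v (suc y) y≢v | inj₂ (v≤y+1 , e) rewrite e with if-<ᵇ-cases y v y (suc y)
...   | inj₁ (y<v , _) = ⊥-elim (y≢v (≤-antisym y<v v≤y+1))
...   | inj₂ (_ , e′)   = e′

bump-<ᵇ : ∀ v y → (bump v y <ᵇ v) ≡ (y <ᵇ v)
bump-<ᵇ v y with if-<ᵇ-cases y v y (suc y)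
... | inj₁ (_ , e)   rewrite e = refl
... | inj₂ (v≤y , e) rewrite e = <ᵇ-cong (λ y+1<v → ⊥-elim (<⇒≱ y+1<v (m≤n⇒m≤1+n v≤y)))
                                         (λ y<v → ⊥-elim (<⇒≱ y<v v≤y))

<ᵇ-bump-below : ∀ u v y → v < u → (v <ᵇ bump u y) ≡ (v <ᵇ y)
<ᵇ-bump-below u v y v<u with if-<ᵇ-cases y u y (suc y)
... | inj₁ (_ , e)   rewrite e = refl
... | inj₂ (u≤y , e) rewrite e = <ᵇ-cong (λ _ → <-≤-trans v<u u≤y) m<n⇒m<1+n

<ᵇ-bump-above : ∀ u v y → u ≤ suc v → (suc v <ᵇ bump u y) ≡ (v <ᵇ y)
<ᵇ-bump-above u v y u≤v+1 with if-<ᵇ-cases y u y (suc y)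
... | inj₂ (_ , e)   rewrite e = refl
... | inj₁ (y<u , e) rewrite e = <ᵇ-cong (λ v+1<y → ⊥-elim (<⇒≱ v+1<y (<⇒≤ (<-≤-trans y<u u≤v+1))))
                                         (λ v<y → ⊥-elim (<⇒≱ v<y (≤-pred (<-≤-trans y<u u≤v+1))))

T-not⁻ : ∀ {b} → T (not b) → ¬ T b
T-not⁻ {false} _ ()

T-not⁺ : ∀ {b} → ¬ T b → T (not b)
T-not⁺ {false} _  = _
T-not⁺ {true}  ¬t = ¬t _

distinct⇒Unique : ∀ xs → T (distinct xs) → Unique xs
distinct⇒Unique []       _ = []
distinct⇒Unique (x ∷ xs) d with Equivalence.to T-∧ d
... | x-new , xs-distinct =
  All.¬Any⇒All¬ xs (λ x∈xs → T-not⁻ x-new (any⁺ _ (Any.map (≡⇒≡ᵇ x _) x∈xs)))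
  ∷ distinct⇒Unique xs xs-distinct

Unique⇒distinct : ∀ {xs} → Unique xs → T (distinct xs)
Unique⇒distinct [] = _
Unique⇒distinct {x ∷ xs} (x∉xs ∷ u) = Equivalence.from T-∧
  (T-not⁺ (λ t → All.All¬⇒¬Any x∉xs (Any.map (≡ᵇ⇒≡ x _) (any⁻ _ xs t))) , Unique⇒distinct u)

words-suc : ∀ n m → words (suc n) m ≡ cartesianProductWith _∷_ (upTo m) (words n m)
words-suc n m = go (upTo m)
  where
  go : ∀ xs → concatMap (λ v → map (v ∷_) (words n m)) xs ≡ cartesianProductWith _∷_ xs (words n m)
  go []       = refl
  go (x ∷ xs) = cong (map (x ∷_) (words n m) ++_) (go xs)

∈-words⁻ : ∀ n m {u} → u ∈ words n m → length u ≡ n × All (_< m) u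
∈-words⁻ zero    m (here refl) = refl , []
∈-words⁻ (suc n) m u∈ with ∈-cartesianProductWith⁻ _∷_ (upTo m) (words n m) (subst (_ ∈_) (words-suc n m) u∈)
... | a , u , a∈ , u∈ , refl with ∈-words⁻ n m u∈
... | len , bounded = cong suc len , ∈-upTo⁻ a∈ ∷ bounded

∈-words⁺ : ∀ n m {u} → length u ≡ n → All (_< m) u → u ∈ words n m
∈-words⁺ zero    m {[]}    _   _              = here refl
∈-words⁺ (suc n) m {a ∷ u} len (a<m ∷ bounded) = subst (_ ∈_) (sym (words-suc n m))
  (∈-cartesianProductWith⁺ _∷_ (∈-upTo⁺ a<m) (∈-words⁺ n m (suc-injective len) bounded))

words-Unique : ∀ n m → Unique (words n m)
words-Unique zero    m = [] ∷ []
words-Unique (suc n) m = subst Unique (sym (words-suc n m))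
  (Unique.cartesianProductWith⁺ _∷_ ∷-injective (Unique.upTo⁺ m) (words-Unique n m))

IsPerm : ℕ → List ℕ → Set
IsPerm n σ = length σ ≡ n × All (λ x → 1 ≤ x × x ≤ n) σ × Unique σ

∈-perms⁻ : ∀ n {σ} → σ ∈ perms n → IsPerm n σ
∈-perms⁻ n σ∈ with ∈-filter⁻ (T? ∘ distinct) {xs = map (map suc) (words n n)} σ∈
... | σ∈′ , σ-distinct with ∈-map⁻ (map suc) σ∈′
... | u , u∈ , refl with ∈-words⁻ n n u∈
... | len , bounded =
  trans (length-map suc u) len ,
  All.map⁺ (All.map (λ x<n → s≤s z≤n , x<n) bounded) ,
  distinct⇒Unique _ σ-distinct

∈-perms⁺ : ∀ n {σ} → IsPerm n σ → σ ∈ perms n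
∈-perms⁺ n {σ} (len , bounded , unique) =
  ∈-filter⁺ (T? ∘ distinct) {xs = map (map suc) (words n n)}
    (subst (_∈ map (map suc) (words n n)) suc-pred-σ
      (∈-map⁺ (map suc) (∈-words⁺ n n (trans (length-map pred σ) len) (All.map⁺ (All.map pred< bounded)))))
    (Unique⇒distinct unique)
  where
  pred< : ∀ {x} → 1 ≤ x × x ≤ n → pred x < n
  pred< {suc x} (_ , x<n) = x<n
  suc-pred-σ : map suc (map pred σ) ≡ σ
  suc-pred-σ = trans (sym (map-∘ σ)) (map-id-local (All.map (λ { {suc x} _ → refl }) bounded))

perms-Unique : ∀ n → Unique (perms n)
perms-Unique n = Unique.filter⁺ (T? ∘ distinct) (Unique.map⁺ (map-injective suc-injective) (words-Unique n n))

length-∷ʳ : ∀ {A : Set} (xs : List A) x → length (xs ∷ʳ x) ≡ suc (length xs)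
length-∷ʳ xs x = trans (length-++ xs) (+-comm (length xs) 1)

Unique-∷ʳ⁺ : ∀ {A : Set} {xs : List A} {x} → Unique xs → x ∉ xs → Unique (xs ∷ʳ x)
Unique-∷ʳ⁺ u x∉xs = Unique.++⁺ u ([] ∷ []) λ { (x∈xs , here refl) → x∉xs x∈xs }

Unique-∷ʳ⁻ : ∀ {A : Set} (xs : List A) {x} → Unique (xs ∷ʳ x) → Unique xs × x ∉ xs
Unique-∷ʳ⁻ []       _          = [] , λ ()
Unique-∷ʳ⁻ (y ∷ xs) (y∉ ∷ u) with All.++⁻ xs y∉ | Unique-∷ʳ⁻ xs u
... | y∉xs , (y≢x ∷ []) | u′ , x∉xs = (y∉xs ∷ u′) , λ { (here x≡y) → y≢x (sym x≡y) ; (there x∈xs) → x∉xs x∈xs }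

-- The permutation of {1,…,n+1} ending in v whose first n entries have the relative order of σ.
insertLast : ℕ → List ℕ → List ℕ
insertLast v σ = map (bump v) σ ∷ʳ v

length-insertLast : ∀ v σ → length (insertLast v σ) ≡ suc (length σ)
length-insertLast v σ = trans (length-∷ʳ (map (bump v) σ) v) (cong suc (length-map (bump v) σ))

insertLast-IsPerm : ∀ n {σ v} → IsPerm n σ → 1 ≤ v → v ≤ suc n → IsPerm (suc n) (insertLast v σ)
insertLast-IsPerm n {σ} {v} (len , bounded , unique) 1≤v v≤n+1 =
  trans (length-insertLast v σ) (cong suc len) ,
  All.++⁺ (All.map⁺ (All.map bump-bounded bounded)) ((1≤v , v≤n+1) ∷ []) ,
  Unique-∷ʳ⁺ (Unique.map⁺ (strictMono⇒injective (bump-<-mono v)) unique) v∉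
  where
  bump-bounded : ∀ {x} → 1 ≤ x × x ≤ n → 1 ≤ bump v x × bump v x ≤ suc n
  bump-bounded {x} (1≤x , x≤n) with if-<ᵇ-cases x v x (suc x)
  ... | inj₁ (_ , e) rewrite e = 1≤x , m≤n⇒m≤1+n x≤n
  ... | inj₂ (_ , e) rewrite e = s≤s z≤n , s≤s x≤n
  v∉ : v ∉ map (bump v) σ
  v∉ v∈ with ∈-map⁻ (bump v) v∈
  ... | x , _ , v≡bump = bump-≢ v x (sym v≡bump)

insertLast-surjective : ∀ n {σ′} → IsPerm (suc n) σ′ →
                        ∃[ v ] ∃[ σ ] IsPerm n σ × 1 ≤ v × v ≤ suc n × σ′ ≡ insertLast v σ
insertLast-surjective n {σ′} perm with initLast σ′
insertLast-surjective n (() , _) | []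
insertLast-surjective n (len , bounded , unique) | ys ∷ʳ′ v
  with All.++⁻ ys bounded | Unique-∷ʳ⁻ ys unique
... | ys-bounded , ((1≤v , v≤n+1) ∷ []) | ys-unique , v∉ys =
  v , map (unbump v) ys ,
  (trans (length-map (unbump v) ys) (suc-injective (trans (sym (length-∷ʳ ys v)) len)) ,
   All.map⁺ (All.tabulate λ y∈ → unbump-bounded (All.lookup ys-bounded y∈) (≢v y∈)) ,
   Unique.map⁻ (subst Unique (sym bump-unbump-ys) ys-unique)) ,
  1≤v , v≤n+1 , cong (_∷ʳ v) (sym bump-unbump-ys)
  where
  ≢v : ∀ {y} → y ∈ ys → y ≢ v
  ≢v y∈ refl = v∉ys y∈
  bump-unbump-ys : map (bump v) (map (unbump v) ys) ≡ ys
  bump-unbump-ys = trans (sym (map-∘ ys)) (map-id-local (All.tabulate λ y∈ → bump-unbump v _ (≢v y∈)))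
  unbump-bounded : ∀ {y} → 1 ≤ y × y ≤ suc n → y ≢ v → 1 ≤ unbump v y × unbump v y ≤ n
  unbump-bounded {y} (1≤y , y≤n+1) y≢v with if-<ᵇ-cases y v y (pred y)
  ... | inj₁ (y<v , e) rewrite e = 1≤y , ≤-pred (≤-trans y<v v≤n+1)
  unbump-bounded {suc y} (_ , y<n+1) y≢v | inj₂ (v≤y+1 , e) rewrite e =
    ≤-trans 1≤v (≤-pred (≤∧≢⇒< v≤y+1 (y≢v ∘ sym))) , ≤-pred y<n+1

inv-∷ʳ : ∀ xs v → inv (xs ∷ʳ v) ≡ inv xs + count (v <ᵇ_) xs
inv-∷ʳ []       v = refl
inv-∷ʳ (x ∷ xs) v = begin
  count (_<ᵇ x) (xs ∷ʳ v) + inv (xs ∷ʳ v)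
    ≡⟨ cong₂ _+_ (count-++ (_<ᵇ x) xs (v ∷ [])) (inv-∷ʳ xs v) ⟩
  (count (_<ᵇ x) xs + count (_<ᵇ x) (v ∷ [])) + (inv xs + count (v <ᵇ_) xs)
    ≡⟨ interchange (count (_<ᵇ x) xs) _ (inv xs) _ ⟩
  (count (_<ᵇ x) xs + inv xs) + (count (_<ᵇ x) (v ∷ []) + count (v <ᵇ_) xs)
    ≡⟨ cong (λ c → inv (x ∷ xs) + (c + count (v <ᵇ_) xs))
            (trans (count-singleton (_<ᵇ x) v) (sym (count-singleton (v <ᵇ_) x))) ⟩
  inv (x ∷ xs) + (count (v <ᵇ_) (x ∷ []) + count (v <ᵇ_) xs)
    ≡⟨ cong (inv (x ∷ xs) +_) (sym (count-++ (v <ᵇ_) (x ∷ []) xs)) ⟩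
  inv (x ∷ xs) + count (v <ᵇ_) (x ∷ xs) ∎
  where open ≡-Reasoning

coinv-∷ʳ : ∀ xs v → coinv (xs ∷ʳ v) ≡ coinv xs + count (_<ᵇ v) xs
coinv-∷ʳ []       v = refl
coinv-∷ʳ (x ∷ xs) v = begin
  count (x <ᵇ_) (xs ∷ʳ v) + coinv (xs ∷ʳ v)
    ≡⟨ cong₂ _+_ (count-++ (x <ᵇ_) xs (v ∷ [])) (coinv-∷ʳ xs v) ⟩
  (count (x <ᵇ_) xs + count (x <ᵇ_) (v ∷ [])) + (coinv xs + count (_<ᵇ v) xs)
    ≡⟨ interchange (count (x <ᵇ_) xs) _ (coinv xs) _ ⟩
  (count (x <ᵇ_) xs + coinv xs) + (count (x <ᵇ_) (v ∷ []) + count (_<ᵇ v) xs)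
    ≡⟨ cong (λ c → coinv (x ∷ xs) + (c + count (_<ᵇ v) xs))
            (trans (count-singleton (x <ᵇ_) v) (sym (count-singleton (_<ᵇ v) x))) ⟩
  coinv (x ∷ xs) + (count (_<ᵇ v) (x ∷ []) + count (_<ᵇ v) xs)
    ≡⟨ cong (coinv (x ∷ xs) +_) (sym (count-++ (_<ᵇ v) (x ∷ []) xs)) ⟩
  coinv (x ∷ xs) + count (_<ᵇ v) (x ∷ xs) ∎
  where open ≡-Reasoning

module _ {f : ℕ → ℕ} (mono : f Preserves _<_ ⟶ _<_) where

  inv-map : ∀ xs → inv (map f xs) ≡ inv xs
  inv-map []       = refl
  inv-map (x ∷ xs) = cong₂ _+_
    (trans (count-map _ f xs) (count-cong xs λ {y} _ → strictMono⇒<ᵇ-invariant mono y x))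
    (inv-map xs)

  coinv-map : ∀ xs → coinv (map f xs) ≡ coinv xs
  coinv-map []       = refl
  coinv-map (x ∷ xs) = cong₂ _+_
    (trans (count-map _ f xs) (count-cong xs λ {y} _ → strictMono⇒<ᵇ-invariant mono x y))
    (coinv-map xs)

  redσ-map : ∀ s → redσ (map f s) ≡ redσ s
  redσ-map s = trans (sym (map-∘ s)) (map-cong (λ x → cong suc
    (trans (count-map _ f s) (count-cong s λ {y} _ → strictMono⇒<ᵇ-invariant mono y x))) s)

norm-∷ʳ : ∀ w a → norm (w ∷ʳ a) ≡ norm w + a
norm-∷ʳ w a = trans (sum-++ w (a ∷ [])) (cong (norm w +_) (+-identityʳ a))

count-larger : ∀ n {σ} → IsPerm n σ → ∀ v → count (v <ᵇ_) σ ≡ n ∸ v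
count-larger zero    {[]}    _        v = sym (0∸n≡0 v)
count-larger zero    {_ ∷ _} (() , _) v
count-larger (suc n) perm v with insertLast-surjective n perm
... | u , τ , τ-perm , 1≤u , u≤n+1 , refl = begin
  count (v <ᵇ_) (map (bump u) τ ∷ʳ u)
    ≡⟨ count-++ (v <ᵇ_) (map (bump u) τ) (u ∷ []) ⟩
  count (v <ᵇ_) (map (bump u) τ) + count (v <ᵇ_) (u ∷ [])
    ≡⟨ cong (_+ count (v <ᵇ_) (u ∷ [])) (count-map (v <ᵇ_) (bump u) τ) ⟩
  count ((v <ᵇ_) ∘ bump u) τ + count (v <ᵇ_) (u ∷ [])
    ≡⟨ split v (v <? u) ⟩
  suc n ∸ v ∎
  where
  open ≡-Reasoning
  split : ∀ v → Dec (v < u) → count ((v <ᵇ_) ∘ bump u) τ + count (v <ᵇ_) (u ∷ []) ≡ suc n ∸ v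
  split v (yes v<u) = trans
    (cong₂ _+_ (trans (count-cong τ λ {y} _ → <ᵇ-bump-below u v y v<u) (count-larger n τ-perm v))
               (cong length (filter-accept (T? ∘ (v <ᵇ_)) {x = u} {xs = []} (<⇒<ᵇ v<u))))
    (trans (+-comm (n ∸ v) 1) (sym (+-∸-assoc 1 (≤-pred (≤-trans v<u u≤n+1)))))
  split zero    (no 0≮u) = ⊥-elim (0≮u 1≤u)
  split (suc v) (no v≮u) = trans
    (cong₂ _+_ (trans (count-cong τ λ {y} _ → <ᵇ-bump-above u v y (≮⇒≥ v≮u)) (count-larger n τ-perm v))
               (cong length (filter-reject (T? ∘ (suc v <ᵇ_)) {x = u} {xs = []} (v≮u ∘ <ᵇ⇒< (suc v) u))))
    (+-identityʳ (n ∸ v))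

not-<ᵇ : ∀ v y → not (v <ᵇ y) ≡ (y <ᵇ suc v)
not-<ᵇ v y = T-injective (λ t → <⇒<ᵇ (s≤s (≮⇒≥ (T-not⁻ t ∘ <⇒<ᵇ {v} {y}))))
                         (λ t → T-not⁺ (λ t′ → <⇒≱ (<ᵇ⇒< v y t′) (≤-pred (<ᵇ⇒< y (suc v) t))))

count-smaller : ∀ n {σ} → IsPerm n σ → ∀ v → v ≤ n → count (_<ᵇ suc v) σ ≡ v
count-smaller n {σ} perm@(len , _) v v≤n = begin
  count (_<ᵇ suc v) σ
    ≡⟨ count-cong σ (λ {y} _ → not-<ᵇ v y) ⟨
  count (not ∘ (v <ᵇ_)) σ
    ≡⟨ m+n∸m≡n (count (v <ᵇ_) σ) _ ⟨
  count (v <ᵇ_) σ + count (not ∘ (v <ᵇ_)) σ ∸ count (v <ᵇ_) σ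
    ≡⟨ cong₂ _∸_ (trans (count+count-not (v <ᵇ_) σ) len) (count-larger n perm v) ⟩
  n ∸ (n ∸ v)
    ≡⟨ m∸[m∸n]≡n v≤n ⟩
  v ∎
  where open ≡-Reasoning

inv-insertLast : ∀ n {σ} → IsPerm n σ → ∀ m → inv (insertLast (suc m) σ) ≡ inv σ + (n ∸ m)
inv-insertLast n {σ} perm m = begin
  inv (map (bump (suc m)) σ ∷ʳ suc m)
    ≡⟨ inv-∷ʳ (map (bump (suc m)) σ) (suc m) ⟩
  inv (map (bump (suc m)) σ) + count (suc m <ᵇ_) (map (bump (suc m)) σ)
    ≡⟨ cong₂ _+_ (inv-map (bump-<-mono (suc m)) σ) (count-map (suc m <ᵇ_) (bump (suc m)) σ) ⟩
  inv σ + count ((suc m <ᵇ_) ∘ bump (suc m)) σ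
    ≡⟨ cong (inv σ +_) (count-cong σ λ {y} _ → <ᵇ-bump-above (suc m) m y ≤-refl) ⟩
  inv σ + count (m <ᵇ_) σ
    ≡⟨ cong (inv σ +_) (count-larger n perm m) ⟩
  inv σ + (n ∸ m) ∎
  where open ≡-Reasoning

coinv-insertLast : ∀ n {σ} → IsPerm n σ → ∀ m → m ≤ n → coinv (insertLast (suc m) σ) ≡ coinv σ + m
coinv-insertLast n {σ} perm m m≤n = begin
  coinv (map (bump (suc m)) σ ∷ʳ suc m)
    ≡⟨ coinv-∷ʳ (map (bump (suc m)) σ) (suc m) ⟩
  coinv (map (bump (suc m)) σ) + count (_<ᵇ suc m) (map (bump (suc m)) σ)
    ≡⟨ cong₂ _+_ (coinv-map (bump-<-mono (suc m)) σ) (count-map (_<ᵇ suc m) (bump (suc m)) σ) ⟩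
  coinv σ + count ((_<ᵇ suc m) ∘ bump (suc m)) σ
    ≡⟨ cong (coinv σ +_) (count-cong σ λ {y} _ → bump-<ᵇ (suc m) y) ⟩
  coinv σ + count (_<ᵇ suc m) σ
    ≡⟨ cong (coinv σ +_) (count-smaller n perm m m≤n) ⟩
  coinv σ + m ∎
  where open ≡-Reasoning

window-++ : ∀ {A : Set} i j (xs ys : List A) → i + j ≤ length xs → take j (drop i (xs ++ ys)) ≡ take j (drop i xs)
window-++ zero    zero    xs       ys _         = refl
window-++ zero    (suc j) (x ∷ xs) ys (s≤s j≤) = cong (x ∷_) (window-++ zero j xs ys j≤)
window-++ (suc i) j       (x ∷ xs) ys (s≤s ij≤) = window-++ i j xs ys ij≤

+-indicator-≡ᵇ : ∀ M b → ((((M + (if b then 1 else 0)) ≡ᵇ 1) ∧ b) ≡ (M ≡ᵇ 0) ∧ b)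
                       × (((M + (if b then 1 else 0)) ≡ᵇ 0) ≡ (M ≡ᵇ 0) ∧ not b)
+-indicator-≡ᵇ M false = trans (∧-zeroʳ _) (sym (∧-zeroʳ _)) ,
                         trans (cong (_≡ᵇ 0) (+-identityʳ M)) (sym (∧-identityʳ _))
+-indicator-≡ᵇ M true rewrite +-comm M 1 = refl , sym (∧-zeroʳ _)

module _ (Υ : List (List ℕ × List ℕ)) (j : ℕ) where

  matchAt-insertLast : ∀ {σ w} v a i → i + j ≤ length σ → i + j ≤ length w →
                       matchAt Υ j (insertLast v σ) (w ∷ʳ a) i ≡ matchAt Υ j σ w i
  matchAt-insertLast {σ} {w} v a i ij≤σ ij≤w = cong₂ (λ τ u → inΥ Υ (τ , u)) reduced-σ (cong redw (window-++ i j w (a ∷ []) ij≤w))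
    where
    reduced-σ : redσ (take j (drop i (map (bump v) σ ∷ʳ v))) ≡ redσ (take j (drop i σ))
    reduced-σ = begin
      redσ (take j (drop i (map (bump v) σ ∷ʳ v)))
        ≡⟨ cong redσ (window-++ i j (map (bump v) σ) (v ∷ []) (subst (i + j ≤_) (sym (length-map (bump v) σ)) ij≤σ)) ⟩
      redσ (take j (drop i (map (bump v) σ)))
        ≡⟨ cong (redσ ∘ take j) (drop-map i σ) ⟩
      redσ (take j (map (bump v) (drop i σ)))
        ≡⟨ cong redσ (take-map j (drop i σ)) ⟩
      redσ (map (bump v) (take j (drop i σ)))
        ≡⟨ redσ-map (bump-<-mono v) (take j (drop i σ)) ⟩
      redσ (take j (drop i σ)) ∎
      where open ≡-Reasoning

  mch-short : ∀ σ w → length σ < j → mch Υ j σ w ≡ 0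
  mch-short σ w σ<j = cong (count (matchAt Υ j σ w) ∘ upTo) (m≤n⇒m∸n≡0 σ<j)

  mch-insertLast : ∀ n {σ w} v a → length σ ≡ n → length w ≡ n → j ≤ suc n →
                   mch Υ j (insertLast v σ) (w ∷ʳ a)
                     ≡ mch Υ j σ w + count (matchAt Υ j (insertLast v σ) (w ∷ʳ a)) ((suc n ∸ j) ∷ [])
  mch-insertLast n {σ} {w} v a lenσ lenw j≤n+1 = begin
    count P (upTo (suc (length σ′) ∸ j))
      ≡⟨ cong (λ L → count P (upTo (suc L ∸ j))) (trans (length-insertLast v σ) (cong suc lenσ)) ⟩
    count P (upTo (suc (suc n) ∸ j))
      ≡⟨ cong (count P ∘ upTo) (+-∸-assoc 1 j≤n+1) ⟩
    count P (upTo (suc m))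
      ≡⟨ cong (count P) (applyUpTo-∷ʳ (λ x → x) m) ⟨
    count P (upTo m ∷ʳ m)
      ≡⟨ count-++ P (upTo m) (m ∷ []) ⟩
    count P (upTo m) + count P (m ∷ [])
      ≡⟨ cong (_+ count P (m ∷ [])) (count-cong (upTo m) earlier-windows) ⟩
    count (matchAt Υ j σ w) (upTo m) + count P (m ∷ [])
      ≡⟨ cong (λ L → count (matchAt Υ j σ w) (upTo (suc L ∸ j)) + count P (m ∷ [])) lenσ ⟨
    mch Υ j σ w + count P (m ∷ []) ∎
    where
    open ≡-Reasoning
    σ′ = insertLast v σ
    P = matchAt Υ j σ′ (w ∷ʳ a)
    m = suc n ∸ j
    earlier-windows : ∀ {i} → i ∈ upTo m → P i ≡ matchAt Υ j σ w i
    earlier-windows {i} i∈ = matchAt-insertLast v a i (subst (i + j ≤_) (sym lenσ) i+j≤n) (subst (i + j ≤_) (sym lenw) i+j≤n)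
      where
      i+j≤n : i + j ≤ n
      i+j≤n = ≤-pred (subst (i + j <_) (m∸n+n≡m j≤n+1) (+-monoˡ-< j (∈-upTo⁻ i∈)))

  -- b records whether the appended letter creates a bi-match in the last window.
  insertLast-splits : ∀ n {σ w} v a → length σ ≡ n → length w ≡ n →
    ∃[ b ] (isEnd Υ j (insertLast v σ , w ∷ʳ a) ≡ avoids Υ j (σ , w) ∧ b)
         × (avoids Υ j (insertLast v σ , w ∷ʳ a) ≡ avoids Υ j (σ , w) ∧ not b)
  insertLast-splits n {σ} {w} v a lenσ lenw with j ≤? suc n
  ... | yes j≤n+1 = b , trans isEnd≡ (proj₁ (+-indicator-≡ᵇ M b)) , trans avoids≡ (proj₂ (+-indicator-≡ᵇ M b))
    where
    σ′ = insertLast v σ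
    w′ = w ∷ʳ a
    b = matchAt Υ j σ′ w′ (suc n ∸ j)
    M = mch Υ j σ w
    mch≡ : mch Υ j σ′ w′ ≡ M + (if b then 1 else 0)
    mch≡ = trans (mch-insertLast n v a lenσ lenw j≤n+1) (cong (M +_) (count-singleton (matchAt Υ j σ′ w′) _))
    isEnd≡ : isEnd Υ j (σ′ , w′) ≡ ((M + (if b then 1 else 0)) ≡ᵇ 1) ∧ b
    isEnd≡ = cong₂ (λ c L → (c ≡ᵇ 1) ∧ matchAt Υ j σ′ w′ (L ∸ j)) mch≡ (trans (length-insertLast v σ) (cong suc lenσ))
    avoids≡ : avoids Υ j (σ′ , w′) ≡ ((M + (if b then 1 else 0)) ≡ᵇ 0)
    avoids≡ = cong (_≡ᵇ 0) mch≡
  ... | no j≰n+1 = false ,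
    trans (cong (λ c → (c ≡ᵇ 1) ∧ matchAt Υ j σ′ w′ (length σ′ ∸ j)) (mch-short σ′ w′ σ′<j)) (sym (∧-zeroʳ _)) ,
    trans (cong (_≡ᵇ 0) (mch-short σ′ w′ σ′<j)) (sym (cong (λ c → (c ≡ᵇ 0) ∧ true) (mch-short σ w σ<j)))
    where
    σ′ = insertLast v σ
    w′ = w ∷ʳ a
    σ′<j : length σ′ < j
    σ′<j = subst (_< j) (sym (trans (length-insertLast v σ) (cong suc lenσ))) (≰⇒> j≰n+1)
    σ<j : length σ < j
    σ<j = subst (_< j) (sym lenσ) (<-trans (n<1+n n) (≰⇒> j≰n+1))

Unique-map⁺-on : ∀ {A B : Set} {f : A → B} {xs} → (∀ {x y} → x ∈ xs → y ∈ xs → f x ≡ f y → x ≡ y) →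
                 Unique xs → Unique (map f xs)
Unique-map⁺-on {xs = []}     _   []         = []
Unique-map⁺-on {xs = x ∷ xs} inj (x∉xs ∷ u) =
  All.map⁺ (All.tabulate λ y∈ fx≡fy → All.lookup x∉xs y∈ (inj (here refl) (there y∈) fx≡fy))
  ∷ Unique-map⁺-on (λ x∈ y∈ → inj (there x∈) (there y∈)) u

wreath-Unique : ∀ k n → Unique (wreath k n)
wreath-Unique k n = Unique.cartesianProduct⁺ (perms-Unique n) (words-Unique n k)

-- Appending the value n + 1 - i makes it larger than exactly i of the earlier entries.
extend : ℕ → (List ℕ × List ℕ) × (ℕ × ℕ) → List ℕ × List ℕ
extend n ((σ , w) , (i , a)) = insertLast (suc (n ∸ i)) σ , w ∷ʳ a

extensions : ℕ → ℕ → List ((List ℕ × List ℕ) × (ℕ × ℕ))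
extensions k n = cartesianProduct (wreath k n) (cartesianProduct (upTo (suc n)) (upTo k))

extensions-Unique : ∀ k n → Unique (extensions k n)
extensions-Unique k n = Unique.cartesianProduct⁺ (wreath-Unique k n) (Unique.cartesianProduct⁺ (Unique.upTo⁺ (suc n)) (Unique.upTo⁺ k))

∈-extensions⁻ : ∀ k n {σ w i a} → ((σ , w) , (i , a)) ∈ extensions k n →
                IsPerm n σ × (length w ≡ n × All (_< k) w) × i ≤ n × a < k
∈-extensions⁻ k n t∈ with ∈-cartesianProduct⁻ (wreath k n) _ t∈
... | x∈ , ia∈ with ∈-cartesianProduct⁻ (perms n) (words n k) x∈ | ∈-cartesianProduct⁻ (upTo (suc n)) (upTo k) ia∈
... | σ∈ , w∈ | i∈ , a∈ = ∈-perms⁻ n σ∈ , ∈-words⁻ n k w∈ , ≤-pred (∈-upTo⁻ i∈) , ∈-upTo⁻ a∈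

∈-extensions⁺ : ∀ k n {σ w i a} → IsPerm n σ → length w ≡ n → All (_< k) w → i ≤ n → a < k →
                ((σ , w) , (i , a)) ∈ extensions k n
∈-extensions⁺ k n perm lenw w<k i≤n a<k =
  ∈-cartesianProduct⁺ (∈-cartesianProduct⁺ (∈-perms⁺ n perm) (∈-words⁺ n k lenw w<k))
                      (∈-cartesianProduct⁺ (∈-upTo⁺ (s≤s i≤n)) (∈-upTo⁺ a<k))

extend-injective : ∀ k n {t t′} → t ∈ extensions k n → t′ ∈ extensions k n → extend n t ≡ extend n t′ → t ≡ t′
extend-injective k n {(σ , w) , (i , a)} {(σ′ , w′) , (i′ , a′)} t∈ t′∈ eq
  with ∈-extensions⁻ k n t∈ | ∈-extensions⁻ k n t′∈
... | _ , _ , i≤n , _ | _ , _ , i′≤n , _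
  with ∷ʳ-injective w w′ (cong proj₂ eq) | ∸-cancelˡ-≡ i≤n i′≤n (suc-injective (∷ʳ-injectiveʳ _ _ (cong proj₁ eq)))
... | refl , refl | refl =
  cong (λ τ → (τ , w) , (i , a))
       (map-injective (strictMono⇒injective (bump-<-mono (suc (n ∸ i)))) (∷ʳ-injectiveˡ _ _ (cong proj₁ eq)))

∈-extend⁺ : ∀ k n {z} → z ∈ map (extend n) (extensions k n) → z ∈ wreath k (suc n)
∈-extend⁺ k n z∈ with ∈-map⁻ (extend n) z∈
... | ((σ , w) , (i , a)) , t∈ , refl with ∈-extensions⁻ k n t∈
... | perm , (lenw , w<k) , i≤n , a<k =
  ∈-cartesianProduct⁺
    (∈-perms⁺ (suc n) (insertLast-IsPerm n perm (s≤s z≤n) (s≤s (m∸n≤m n i))))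
    (∈-words⁺ (suc n) k (trans (length-∷ʳ w a) (cong suc lenw)) (All.++⁺ w<k (a<k ∷ [])))

∈-extend⁻ : ∀ k n {z} → z ∈ wreath k (suc n) → z ∈ map (extend n) (extensions k n)
∈-extend⁻ k n {σ′ , w′} z∈ with ∈-cartesianProduct⁻ (perms (suc n)) (words (suc n) k) z∈
... | σ′∈ , w′∈ with insertLast-surjective n (∈-perms⁻ (suc n) σ′∈) | ∈-words⁻ (suc n) k w′∈ | initLast w′
... | _ | () , _ | []
... | suc m , σ , perm , _ , m<n+1 , refl | lenw′ , w′<k | w ∷ʳ′ a with All.++⁻ w w′<k
... | w<k , (a<k ∷ []) =
  subst (_∈ map (extend n) (extensions k n)) extend≡
    (∈-map⁺ (extend n) (∈-extensions⁺ k n perm (suc-injective (trans (sym (length-∷ʳ w a)) lenw′)) w<k (m∸n≤m n m) a<k))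
  where
  extend≡ : extend n ((σ , w) , (n ∸ m , a)) ≡ (insertLast (suc m) σ , w ∷ʳ a)
  extend≡ = cong (λ v → insertLast (suc v) σ , w ∷ʳ a) (m∸[m∸n]≡n (≤-pred m<n+1))

module RingSumsProperties {c ℓ : Level} (R : CommutativeRing c ℓ) where
  open CommutativeRing R hiding (_+_; +-identityʳ; refl; sym; trans; reflexive)
  open CommutativeRing R using ()
    renaming (_+_ to _+R_; +-identityʳ to +R-identityʳ; refl to ≈-refl; sym to ≈-sym; trans to ≈-trans; reflexive to ≈-reflexive)
  open RingSums R
  open import Relation.Binary.Reasoning.Setoid setoid
  open CommSemigroup +-commutativeSemigroup using () renaming (interchange to +R-interchange)
  open CommSemigroup *-commutativeSemigroup using () renaming (interchange to *-interchange)

  sumOver : {X : Set} → (X → Carrier) → List X → Carrier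
  sumOver f xs = sumR (map f xs)

  [_]·_ : Bool → Carrier → Carrier
  [ b ]· x = if b then x else 0#

  private variable X Y : Set


  sumOver-++ : ∀ (f : X → Carrier) xs ys → sumOver f (xs ++ ys) ≈ sumOver f xs +R sumOver f ys
  sumOver-++ f []       ys = ≈-sym (+-identityˡ _)
  sumOver-++ f (x ∷ xs) ys = ≈-trans (+-congˡ (sumOver-++ f xs ys)) (≈-sym (+-assoc _ _ _))

  sumOver-cong : ∀ {f g : X → Carrier} xs → (∀ {x} → x ∈ xs → f x ≈ g x) → sumOver f xs ≈ sumOver g xs
  sumOver-cong []       _  = ≈-refl
  sumOver-cong (x ∷ xs) eq = +-cong (eq (here refl)) (sumOver-cong xs (eq ∘ there))

  sumOver-+ : ∀ (f g : X → Carrier) xs → sumOver (λ x → f x +R g x) xs ≈ sumOver f xs +R sumOver g xs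
  sumOver-+ f g []       = ≈-sym (+-identityˡ _)
  sumOver-+ f g (x ∷ xs) = ≈-trans (+-congˡ (sumOver-+ f g xs)) (+R-interchange _ _ _ _)

  sumOver-*ˡ : ∀ a (f : X → Carrier) xs → sumOver (λ x → a * f x) xs ≈ a * sumOver f xs
  sumOver-*ˡ a f []       = ≈-sym (zeroʳ a)
  sumOver-*ˡ a f (x ∷ xs) = ≈-trans (+-congˡ (sumOver-*ˡ a f xs)) (≈-sym (distribˡ _ _ _))

  sumOver-*ʳ : ∀ a (f : X → Carrier) xs → sumOver (λ x → f x * a) xs ≈ sumOver f xs * a
  sumOver-*ʳ a f []       = ≈-sym (zeroˡ a)
  sumOver-*ʳ a f (x ∷ xs) = ≈-trans (+-congˡ (sumOver-*ʳ a f xs)) (≈-sym (distribʳ _ _ _))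

  sumOver-filter : ∀ (P : X → Bool) (f : X → Carrier) xs → sumOver f (filterᵇ P xs) ≈ sumOver (λ x → [ P x ]· f x) xs
  sumOver-filter P f []       = ≈-refl
  sumOver-filter P f (x ∷ xs) with P x
  ... | true  = +-congˡ (sumOver-filter P f xs)
  ... | false = ≈-trans (sumOver-filter P f xs) (≈-sym (+-identityˡ _))

  sumOver-map : ∀ (f : Y → Carrier) (g : X → Y) xs → sumOver f (map g xs) ≡ sumOver (f ∘ g) xs
  sumOver-map f g xs = cong sumR (sym (map-∘ xs))

  sumOver-cartesianProduct : ∀ (f : X × Y → Carrier) xs ys →
                             sumOver f (cartesianProduct xs ys) ≈ sumOver (λ x → sumOver (λ y → f (x , y)) ys) xs
  sumOver-cartesianProduct f []       ys = ≈-refl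
  sumOver-cartesianProduct f (x ∷ xs) ys = ≈-trans (sumOver-++ f (map (x ,_) ys) (cartesianProduct xs ys))
    (+-cong (≈-reflexive (sumOver-map f (x ,_) ys)) (sumOver-cartesianProduct f xs ys))

  sumOver-↭ : ∀ (f : X → Carrier) {xs ys} → xs ↭ ys → sumOver f xs ≈ sumOver f ys
  sumOver-↭ f xs↭ys = ↭ₛ.foldr-commMonoid setoid +-isCommutativeMonoid (↭⇒↭ₛ′ isEquivalence (↭.map⁺ f xs↭ys))

  sumOver-sameElements : ∀ (f : X → Carrier) {xs ys} → Unique xs → Unique ys → (∀ {z} → z ∈ xs ⇔ z ∈ ys) →
                         sumOver f xs ≈ sumOver f ys
  sumOver-sameElements f ux uy xs⇔ys = sumOver-↭ f (∼bag⇒↭ (unique∧set⇒bag ux uy xs⇔ys))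

  pow-+ : ∀ x m n → pow x (m + n) ≈ pow x m * pow x n
  pow-+ x zero    n = ≈-sym (*-identityˡ _)
  pow-+ x (suc m) n = ≈-trans (*-congˡ (pow-+ x m n)) (≈-sym (*-assoc _ _ _))

  [∧]+[∧not] : ∀ a b x → [ a ∧ b ]· x +R [ a ∧ not b ]· x ≈ [ a ]· x
  [∧]+[∧not] false _     _ = +-identityˡ 0#
  [∧]+[∧not] true  true  x = +R-identityʳ x
  [∧]+[∧not] true  false x = +-identityˡ x

  []·-cong : ∀ a {x y} → x ≈ y → [ a ]· x ≈ [ a ]· y
  []·-cong false _   = ≈-refl
  []·-cong true  x≈y = x≈y

  []·-*ʳ : ∀ a x y → [ a ]· (x * y) ≈ [ a ]· x * y
  []·-*ʳ false x y = ≈-sym (zeroˡ y)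
  []·-*ʳ true  x y = ≈-refl

  sumOver-product : ∀ (f : X → Carrier) (g : Y → Carrier) xs ys →
                    sumOver (λ x → sumOver (λ y → f x * g y) ys) xs ≈ sumOver f xs * sumOver g ys
  sumOver-product f g xs ys = ≈-trans (sumOver-cong xs λ {x} _ → sumOver-*ˡ (f x) g ys) (sumOver-*ʳ (sumOver g ys) f xs)

module _ {c ℓ : Level} (R : CommutativeRing c ℓ) (k j : ℕ) (Υ : List (List ℕ × List ℕ)) (p q r : CommutativeRing.Carrier R) where
  open CommutativeRing R hiding (_+_; +-identityʳ; refl; sym; trans; reflexive)
  open CommutativeRing R using ()
    renaming (_+_ to _+R_; +-identityʳ to +R-identityʳ; refl to ≈-refl; sym to ≈-sym; trans to ≈-trans; reflexive to ≈-reflexive)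
  open RingSums R
  open RingSumsProperties R
  open import Relation.Binary.Reasoning.Setoid setoid
  open CommSemigroup *-commutativeSemigroup using () renaming (interchange to *-interchange)

  W : List ℕ × List ℕ → Carrier
  W = weight p q r

  weight-extend : ∀ n {σ w i a} → IsPerm n σ → i ≤ n →
                  W (extend n ((σ , w) , (i , a))) ≈ W (σ , w) * ((pow p (n ∸ i) * pow q i) * pow r a)
  weight-extend n {σ} {w} {i} {a} perm i≤n = begin
    pow q (inv σ′) * pow p (coinv σ′) * pow r (norm (w ∷ʳ a))
      ≡⟨ cong₂ (λ s t → pow q s * pow p t * pow r (norm (w ∷ʳ a))) inv≡ (coinv-insertLast n perm (n ∸ i) (m∸n≤m n i)) ⟩
    pow q (inv σ + i) * pow p (coinv σ + (n ∸ i)) * pow r (norm (w ∷ʳ a))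
      ≡⟨ cong (λ s → pow q (inv σ + i) * pow p (coinv σ + (n ∸ i)) * pow r s) (norm-∷ʳ w a) ⟩
    pow q (inv σ + i) * pow p (coinv σ + (n ∸ i)) * pow r (norm w + a)
      ≈⟨ *-cong (*-cong (pow-+ q (inv σ) i) (pow-+ p (coinv σ) (n ∸ i))) (pow-+ r (norm w) a) ⟩
    (pow q (inv σ) * pow q i) * (pow p (coinv σ) * pow p (n ∸ i)) * (pow r (norm w) * pow r a)
      ≈⟨ *-congʳ (*-interchange _ _ _ _) ⟩
    (pow q (inv σ) * pow p (coinv σ)) * (pow q i * pow p (n ∸ i)) * (pow r (norm w) * pow r a)
      ≈⟨ *-interchange _ _ _ _ ⟩
    W (σ , w) * ((pow q i * pow p (n ∸ i)) * pow r a)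
      ≈⟨ *-congˡ (*-congʳ (*-comm _ _)) ⟩
    W (σ , w) * ((pow p (n ∸ i) * pow q i) * pow r a) ∎
    where
    σ′ = insertLast (suc (n ∸ i)) σ
    inv≡ : inv σ′ ≡ inv σ + i
    inv≡ = trans (inv-insertLast n perm (n ∸ i)) (cong (inv σ +_) (m∸[m∸n]≡n i≤n))

  A B : ℕ → Carrier
  A = Acoef k j Υ p q r
  B = Bcoef k j Υ p q r

  endOrAvoiding : List ℕ × List ℕ → Carrier
  endOrAvoiding z = [ isEnd Υ j z ]· W z +R [ avoids Υ j z ]· W z

  endOrAvoiding-extend : ∀ n {σ w i a} → IsPerm n σ → length w ≡ n → i ≤ n →
             endOrAvoiding (extend n ((σ , w) , (i , a))) ≈ [ avoids Υ j (σ , w) ]· W (σ , w) * ((pow p (n ∸ i) * pow q i) * pow r a)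
  endOrAvoiding-extend n {σ} {w} {i} {a} perm lenw i≤n with insertLast-splits Υ j n (suc (n ∸ i)) a (proj₁ perm) lenw
  ... | b , isEnd≡ , avoids≡ = begin
    [ isEnd Υ j e ]· W e +R [ avoids Υ j e ]· W e
      ≡⟨ cong₂ (λ s t → [ s ]· W e +R [ t ]· W e) isEnd≡ avoids≡ ⟩
    [ avoids Υ j (σ , w) ∧ b ]· W e +R [ avoids Υ j (σ , w) ∧ not b ]· W e
      ≈⟨ [∧]+[∧not] (avoids Υ j (σ , w)) b (W e) ⟩
    [ avoids Υ j (σ , w) ]· W e
      ≈⟨ []·-cong (avoids Υ j (σ , w)) (weight-extend n {w = w} {a = a} perm i≤n) ⟩
    [ avoids Υ j (σ , w) ]· (W (σ , w) * ((pow p (n ∸ i) * pow q i) * pow r a))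
      ≈⟨ []·-*ʳ (avoids Υ j (σ , w)) _ _ ⟩
    [ avoids Υ j (σ , w) ]· W (σ , w) * ((pow p (n ∸ i) * pow q i) * pow r a) ∎
    where e = extend n ((σ , w) , (i , a))

  fiber-sum : ∀ n {x} → x ∈ wreath k n →
              sumOver (λ ia → endOrAvoiding (extend n (x , ia))) (cartesianProduct (upTo (suc n)) (upTo k))
                ≈ [ avoids Υ j x ]· W x * (qint p q (suc n) * rint r k)
  fiber-sum n {σ , w} x∈ with ∈-cartesianProduct⁻ (perms n) (words n k) x∈
  ... | σ∈ , w∈ = begin
    sumOver (λ ia → endOrAvoiding (extend n ((σ , w) , ia))) (cartesianProduct (upTo (suc n)) (upTo k))
      ≈⟨ sumOver-cartesianProduct _ (upTo (suc n)) (upTo k) ⟩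
    sumOver (λ i → sumOver (λ a → endOrAvoiding (extend n ((σ , w) , (i , a)))) (upTo k)) (upTo (suc n))
      ≈⟨ sumOver-cong (upTo (suc n)) (λ i∈ → sumOver-cong (upTo k) λ _ →
           endOrAvoiding-extend n (∈-perms⁻ n σ∈) (proj₁ (∈-words⁻ n k w∈)) (≤-pred (∈-upTo⁻ i∈))) ⟩
    sumOver (λ i → sumOver (λ a → wx * (g i * pow r a)) (upTo k)) (upTo (suc n))
      ≈⟨ sumOver-cong (upTo (suc n)) (λ {i} _ → sumOver-*ˡ wx (λ a → g i * pow r a) (upTo k)) ⟩
    sumOver (λ i → wx * sumOver (λ a → g i * pow r a) (upTo k)) (upTo (suc n))
      ≈⟨ sumOver-*ˡ wx _ (upTo (suc n)) ⟩
    wx * sumOver (λ i → sumOver (λ a → g i * pow r a) (upTo k)) (upTo (suc n))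
      ≈⟨ *-congˡ (sumOver-product g (pow r) (upTo (suc n)) (upTo k)) ⟩
    wx * (qint p q (suc n) * rint r k) ∎
    where
    wx = [ avoids Υ j (σ , w) ]· W (σ , w)
    g : ℕ → Carrier
    g i = pow p (n ∸ i) * pow q i

  Bcoef+Acoef : ∀ n → B (suc n) +R A (suc n) ≈ A n * (qint p q (suc n) * rint r k)
  Bcoef+Acoef n = begin
    B (suc n) +R A (suc n)
      ≈⟨ +-cong (sumOver-filter (isEnd Υ j) W (wreath k (suc n))) (sumOver-filter (avoids Υ j) W (wreath k (suc n))) ⟩
    sumOver (λ z → [ isEnd Υ j z ]· W z) (wreath k (suc n)) +R sumOver (λ z → [ avoids Υ j z ]· W z) (wreath k (suc n))
      ≈⟨ sumOver-+ _ _ (wreath k (suc n)) ⟨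
    sumOver endOrAvoiding (wreath k (suc n))
      ≈⟨ sumOver-sameElements endOrAvoiding (Unique-map⁺-on (extend-injective k n) (extensions-Unique k n)) (wreath-Unique k (suc n))
                              (mk⇔ (∈-extend⁺ k n) (∈-extend⁻ k n)) ⟨
    sumOver endOrAvoiding (map (extend n) (extensions k n))
      ≡⟨ sumOver-map endOrAvoiding (extend n) (extensions k n) ⟩
    sumOver (endOrAvoiding ∘ extend n) (extensions k n)
      ≈⟨ sumOver-cartesianProduct (endOrAvoiding ∘ extend n) (wreath k n) _ ⟩
    sumOver (λ x → sumOver (λ ia → endOrAvoiding (extend n (x , ia))) (cartesianProduct (upTo (suc n)) (upTo k))) (wreath k n)
      ≈⟨ sumOver-cong (wreath k n) (fiber-sum n) ⟩
    sumOver (λ x → [ avoids Υ j x ]· W x * (qint p q (suc n) * rint r k)) (wreath k n)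
      ≈⟨ sumOver-*ʳ _ _ (wreath k n) ⟩
    sumOver (λ x → [ avoids Υ j x ]· W x) (wreath k n) * (qint p q (suc n) * rint r k)
      ≈⟨ *-congʳ (sumOver-filter (avoids Υ j) W (wreath k n)) ⟨
    A n * (qint p q (suc n) * rint r k) ∎

  Acoef-zero : 1 ≤ j → A 0 ≈ 1#
  Acoef-zero 1≤j = begin
    A 0
      ≈⟨ sumOver-filter (avoids Υ j) W (wreath k 0) ⟩
    [ avoids Υ j ([] , []) ]· W ([] , []) +R 0#
      ≡⟨ cong (λ m → [ m ≡ᵇ 0 ]· W ([] , []) +R 0#) (mch-short Υ j [] [] 1≤j) ⟩
    (1# * 1#) * 1# +R 0#
      ≈⟨ ≈-trans (+R-identityʳ _) (≈-trans (*-identityʳ _) (*-identityʳ _)) ⟩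
    1# ∎

  Bcoef-recurrence : ∀ n → B (suc n) ≈ (rint r k * qint p q (suc n) * A n) - A (suc n)
  Bcoef-recurrence n = begin
    B (suc n)
      ≈⟨ //-rightDividesʳ (A (suc n)) (B (suc n)) ⟨
    (B (suc n) +R A (suc n)) - A (suc n)
      ≈⟨ +-congʳ (Bcoef+Acoef n) ⟩
    A n * (qint p q (suc n) * rint r k) - A (suc n)
      ≈⟨ +-congʳ (≈-trans (*-comm _ _) (*-congʳ (*-comm _ _))) ⟩
    rint r k * qint p q (suc n) * A n - A (suc n) ∎
    where open Algebra.Properties.Group +-group using (//-rightDividesʳ)

lemma9 : {c ℓ : Level} (R : CommutativeRing c ℓ) (k j : ℕ) (Υ : List (List ℕ × List ℕ))
         → 2 ≤ k → 1 ≤ j → ValidΥ k j Υ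
         → (p q r : CommutativeRing.Carrier R)
         → let open CommutativeRing R
               open RingSums R
           in (RingSums.Acoef R k j Υ p q r 0 ≈ 1#)
              × ((n : ℕ) → Bcoef k j Υ p q r (suc n)
                   ≈ (rint r k * qint p q (suc n) * Acoef k j Υ p q r n) - Acoef k j Υ p q r (suc n))
lemma9 R k j Υ _ 1≤j _ p q r = Acoef-zero R k j Υ p q r 1≤j , Bcoef-recurrence R k j Υ p q r
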